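{- Let $s\ge t\ge 3$ be odd integers. Then the sets $Z_0^{s,t},Z_1^{s,t},\ldots,Z_{t-1}^{s,t}$ defined below form a partition of the edge set of $C_s\,\Box\, C_t$.
   Context: For a positive integer $n$ let $[n]_0=\{0,1,\ldots,n-1\}$. The graph $C_s\,\Box\, C_t$ (Cartesian product of the cycles on $s$ and $t$ vertices) has vertex set $[s]_0\times[t]_0$, where $(j,k)$ is adjacent to $(j,(k\pm1)\bmod t)$ and to $((j\pm 1)\bmod s,k)$. For $j\in[s]_0$ and $k\in[t]_0$ define the edges $v^+_{j,k}=(j,k)(j,(k+1)\bmod t)$, $v^-_{j,k}=(j,k)(j,(k-1)\bmod t)$ and $h_{j,k}=(j,k)((j+1)\bmod s,k)$; second indices are always read modulo $t$. Let $\ell=\frac{s-t}{2}\bmod t$ and $h=\lfloor\frac{s-t}{2t}\rfloor$. For $i\in[t]_0$ let $Z_i^{s,t}=Z_{i,1}^{s,t}\cup Z_{i,2}^{s,t}\cup Z_{i,3}^{s,t}$, where $Z_{i,1}^{s,t}=\{v^+_{j,i+j},\,h_{j,i+j+1} : j\in[\ell]_0\}$, $Z_{i,2}^{s,t}=\{v^-_{j+\ell,i-j+\ell},\,h_{j+\ell,i-j+\ell-1} : j\in[\ell]_0\}$, and $Z_{i,3}^{s,t}=\{v^-_{j+2\ell,i-j},\,h_{j+2\ell,i-j-1} : j\in[t(2h+1)]_0\}$ (with $[0]_0=\emptyset$). -}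

module Defs where

open import Data.Nat using (ℕ; zero; suc; _+_; _*_; _∸_; _<_)
import Data.Nat as ℕ
open import Data.Integer using (ℤ; +_; _%ℕ_)
import Data.Integer as ℤ
open import Data.Product using (Σ; ∃; _×_; _,_)
open import Data.Sum using (_⊎_)
open import Relation.Binary.PropositionalEquality using (_≡_)

-- natural-number / integer reduction modulo n (total: the modulus-0 case is
-- never used below since s, t ≥ 3)
_%′_ : ℕ → ℕ → ℕ
m %′ zero  = m
m %′ suc n = m ℕ.% suc n

_/′_ : ℕ → ℕ → ℕ
m /′ zero  = zero
m /′ suc n = m ℕ./ suc n

zmod : ℤ → ℕ → ℕ
zmod z zero    = ℤ.∣ z ∣
zmod z (suc n) = z %ℕ suc n

Odd : ℕ → Set
Odd n = ∃ λ m → n ≡ suc (2 * m)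

Vertex : Set
Vertex = ℕ × ℕ

IsVertex : ℕ → ℕ → Vertex → Set
IsVertex s t (j , k) = j < s × k < t

Adj : ℕ → ℕ → Vertex → Vertex → Set
Adj s t (j , k) (j′ , k′) =
  (j′ ≡ j × (k′ ≡ zmod (+ k ℤ.+ ℤ.+ 1) t ⊎ k′ ≡ zmod (+ k ℤ.- ℤ.+ 1) t))
  ⊎ (k′ ≡ k × (j′ ≡ zmod (+ j ℤ.+ ℤ.+ 1) s ⊎ j′ ≡ zmod (+ j ℤ.- ℤ.+ 1) s))

-- an edge is an unordered pair of vertices, represented by an ordered
-- pair up to the equivalence SameEdge
Edge : Set
Edge = Vertex × Vertex

SameEdge : Edge → Edge → Set
SameEdge (u , v) (u′ , v′) = (u ≡ u′ × v ≡ v′) ⊎ (u ≡ v′ × v ≡ u′)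

IsEdge : ℕ → ℕ → Edge → Set
IsEdge s t (u , v) = IsVertex s t u × IsVertex s t v × Adj s t u v

vplus : ℕ → ℕ → ℕ → ℤ → Edge
vplus s t j k = ((j , zmod k t) , (j , zmod (k ℤ.+ ℤ.+ 1) t))

vminus : ℕ → ℕ → ℕ → ℤ → Edge
vminus s t j k = ((j , zmod k t) , (j , zmod (k ℤ.- ℤ.+ 1) t))

hor : ℕ → ℕ → ℕ → ℤ → Edge
hor s t j k = ((j , zmod k t) , ((suc j) %′ s , zmod k t))

ell : ℕ → ℕ → ℕ
ell s t = ((s ∸ t) /′ 2) %′ t

hh : ℕ → ℕ → ℕ
hh s t = (s ∸ t) /′ (2 * t)

InZ1 : ℕ → ℕ → ℕ → Edge → Set
InZ1 s t i e = Σ ℕ λ j → j < ell s t ×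
  (SameEdge e (vplus s t j (+ i ℤ.+ + j))
   ⊎ SameEdge e (hor s t j (+ i ℤ.+ + j ℤ.+ ℤ.+ 1)))

InZ2 : ℕ → ℕ → ℕ → Edge → Set
InZ2 s t i e = Σ ℕ λ j → j < ell s t ×
  (SameEdge e (vminus s t (j + ell s t) (+ i ℤ.- + j ℤ.+ + ell s t))
   ⊎ SameEdge e (hor s t (j + ell s t) (+ i ℤ.- + j ℤ.+ + ell s t ℤ.- ℤ.+ 1)))

InZ3 : ℕ → ℕ → ℕ → Edge → Set
InZ3 s t i e = Σ ℕ λ j → j < t * (2 * hh s t + 1) ×
  (SameEdge e (vminus s t (j + 2 * ell s t) (+ i ℤ.- + j))
   ⊎ SameEdge e (hor s t (j + 2 * ell s t) (+ i ℤ.- + j ℤ.- ℤ.+ 1)))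

InZ : ℕ → ℕ → ℕ → Edge → Set
InZ s t i e = InZ1 s t i e ⊎ InZ2 s t i e ⊎ InZ3 s t i e

IsEdgePartition : ℕ → ℕ → Set
IsEdgePartition s t =
  (∀ i → i < t → ∀ e → InZ s t i e → IsEdge s t e)
  × (∀ i → i < t → ∃ λ e → InZ s t i e)
  × (∀ e → IsEdge s t e → ∃ λ i → i < t × InZ s t i e)
  × (∀ i i′ e → i < t → i′ < t → InZ s t i e → InZ s t i′ e → i ≡ i′)

-- Call j the column of v⁺_{j,k}, v⁻_{j,k} and h_{j,k}. Since s − t = 2(ℓ + h t), i.e.
-- s = 2ℓ + t(2h+1), the families Z_{i,1}, Z_{i,2}, Z_{i,3} fill the consecutive column blocks
-- [0,ℓ), [ℓ,2ℓ), [2ℓ,s), and Z_i contains exactly one vertical edge v⁺_{j, i + vOffset j} and one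
-- horizontal edge h_{j, i + hOffset j} in every column j, the offsets climbing by one per column
-- on the first block and descending by one afterwards. For a fixed column, i ↦ i + offset is a
-- bijection of ℤ/t, so every edge of C_s □ C_t lies in exactly one Z_i; t, s ≥ 3 ensures that
-- an edge determines its column and position (no two of the named edges coincide by wrap-around).
module Submission where

open import Data.Empty using (⊥-elim)
open import Data.Integer.Base as ℤ using (ℤ; +_; -[1+_]; _%ℕ_; _/ℕ_)
import Data.Integer.Properties as ℤ
open import Data.Integer.DivMod using (n%ℕd<d; a≡a%ℕn+[a/ℕn]*n)
import Data.Integer.Tactic.RingSolver as ℤ-Ring
open import Data.List.Base using (_∷_; [])
open import Data.Nat.Base as ℕ
  using (ℕ; zero; suc; _+_; _*_; _∸_; _%_; _/_; _≤_; _<_; z≤n; s≤s; NonZero)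
import Data.Nat.Properties as ℕ
open import Data.Nat.DivMod using (m≡m%n+[m/n]*n; m<n⇒m%n≡m; m%n<n; m*n/n≡m; m*n/m*o≡n/o)
import Data.Nat.Tactic.RingSolver as ℕ-Ring
open import Data.Product using (∃; ∃₂; _×_; _,_)
open import Data.Product.Properties using (,-injectiveˡ; ,-injectiveʳ)
open import Data.Sum as Sum using (_⊎_; inj₁; inj₂)
open import Relation.Nullary using (¬_; yes; no)
open import Relation.Binary.PropositionalEquality
open ≡-Reasoning

open import Defs

x≡y+k*z⇒y≡x-k*z : ∀ (x y k z : ℤ) → x ≡ y ℤ.+ k ℤ.* z → y ≡ x ℤ.+ ℤ.- k ℤ.* z
x≡y+k*z⇒y≡x-k*z .(y ℤ.+ k ℤ.* z) y k z refl = ℤ-Ring.solve (y ∷ k ∷ z ∷ [])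

remainder-unique : ∀ {d r r′} (k : ℤ) → r < d → r′ < d → + r ≡ + r′ ℤ.+ k ℤ.* + d → r ≡ r′
remainder-unique (+ zero) _ _ eq = trans (ℤ.+-injective eq) (ℕ.+-identityʳ _)
remainder-unique {d} {r} {r′} (+ suc m) r<d _ eq = ⊥-elim (ℕ.<⇒≱ r<d d≤r)
  where
  r≡ : r ≡ r′ + suc m * d
  r≡ = ℤ.+-injective (trans eq (cong (λ z → + r′ ℤ.+ z) (sym (ℤ.pos-* (suc m) d))))
  d≤r : d ≤ r
  d≤r = subst (d ≤_) (sym r≡) (ℕ.≤-trans (ℕ.m≤m+n d (m * d)) (ℕ.m≤n+m _ r′))
remainder-unique {d} {r} {r′} -[1+ m ] r<d r′<d eq =
  sym (remainder-unique (+ suc m) r′<d r<d (x≡y+k*z⇒y≡x-k*z (+ r) (+ r′) -[1+ m ] (+ d) eq))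

[m+k]%n≢m : ∀ {n} .{{_ : NonZero n}} m {k} → 0 < k → k < n → (m + k) % n ≢ m
[m+k]%n≢m {n} m {k} 0<k k<n eq = k≢q*n ((m + k) / n)
  (ℕ.+-cancelˡ-≡ m _ _ (trans (m≡m%n+[m/n]*n (m + k) n) (cong (_+ (m + k) / n * n) eq)))
  where
  k≢q*n : ∀ q → k ≢ q * n
  k≢q*n zero    k≡0 = ℕ.<⇒≢ 0<k (sym k≡0)
  k≢q*n (suc q) k≡  = ℕ.<⇒≱ k<n (subst (n ≤_) (sym k≡) (ℕ.m≤m+n n (q * n)))

module _ {d : ℕ} .{{_ : NonZero d}} where

  %ℕ-periodic : ∀ (x k : ℤ) → (x ℤ.+ k ℤ.* + d) %ℕ d ≡ x %ℕ d
  %ℕ-periodic x k = remainder-unique (qx ℤ.+ k ℤ.- qy) (n%ℕd<d y d) (n%ℕd<d x d) (begin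
    + ry                                         ≡⟨ x≡y+k*z⇒y≡x-k*z y (+ ry) qy (+ d) (a≡a%ℕn+[a/ℕn]*n y d) ⟩
    y ℤ.+ ℤ.- qy ℤ.* + d                         ≡⟨ cong (λ z → z ℤ.+ k ℤ.* + d ℤ.+ ℤ.- qy ℤ.* + d)
                                                         (a≡a%ℕn+[a/ℕn]*n x d) ⟩
    + rx ℤ.+ qx ℤ.* + d ℤ.+ k ℤ.* + d ℤ.+ ℤ.- qy ℤ.* + d ≡⟨ regroup (+ rx) qx k qy (+ d) ⟩
    + rx ℤ.+ (qx ℤ.+ k ℤ.- qy) ℤ.* + d           ∎)
    where
    y = x ℤ.+ k ℤ.* + d
    rx = x %ℕ d
    qx = x /ℕ d
    ry = y %ℕ d
    qy = y /ℕ d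
    regroup : ∀ (r q k q′ D : ℤ) →
              r ℤ.+ q ℤ.* D ℤ.+ k ℤ.* D ℤ.+ ℤ.- q′ ℤ.* D ≡ r ℤ.+ (q ℤ.+ k ℤ.- q′) ℤ.* D
    regroup = ℤ-Ring.solve-∀

  %ℕ-absorbˡ : ∀ (x w : ℤ) → (+ (x %ℕ d) ℤ.+ w) %ℕ d ≡ (x ℤ.+ w) %ℕ d
  %ℕ-absorbˡ x w = sym (begin
    (x ℤ.+ w) %ℕ d                                  ≡⟨ cong (λ z → (z ℤ.+ w) %ℕ d) (a≡a%ℕn+[a/ℕn]*n x d) ⟩
    (+ (x %ℕ d) ℤ.+ x /ℕ d ℤ.* + d ℤ.+ w) %ℕ d      ≡⟨ cong (_%ℕ d) (exchange (+ (x %ℕ d)) (x /ℕ d ℤ.* + d) w) ⟩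
    (+ (x %ℕ d) ℤ.+ w ℤ.+ x /ℕ d ℤ.* + d) %ℕ d      ≡⟨ %ℕ-periodic (+ (x %ℕ d) ℤ.+ w) (x /ℕ d) ⟩
    (+ (x %ℕ d) ℤ.+ w) %ℕ d                         ∎)
    where
    exchange : ∀ (a b c : ℤ) → a ℤ.+ b ℤ.+ c ≡ a ℤ.+ c ℤ.+ b
    exchange = ℤ-Ring.solve-∀

  %ℕ-add-sub : ∀ (x w : ℤ) → (+ ((x ℤ.+ w) %ℕ d) ℤ.- w) %ℕ d ≡ x %ℕ d
  %ℕ-add-sub x w = trans (%ℕ-absorbˡ (x ℤ.+ w) (ℤ.- w)) (cong (_%ℕ d) (cancel x w))
    where
    cancel : ∀ (x w : ℤ) → x ℤ.+ w ℤ.- w ≡ x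
    cancel = ℤ-Ring.solve-∀

  %ℕ-sub-add : ∀ (x c : ℤ) → (+ ((x ℤ.- c) %ℕ d) ℤ.+ c) %ℕ d ≡ x %ℕ d
  %ℕ-sub-add x c = trans (%ℕ-absorbˡ (x ℤ.- c) c) (cong (_%ℕ d) (cancel x c))
    where
    cancel : ∀ (x c : ℤ) → x ℤ.- c ℤ.+ c ≡ x
    cancel = ℤ-Ring.solve-∀

  %ℕ-shift-inverse : ∀ {k k′} (w : ℤ) → k < d → k′ ≡ (+ k ℤ.+ w) %ℕ d → k ≡ (+ k′ ℤ.- w) %ℕ d
  %ℕ-shift-inverse w k<d refl = sym (trans (%ℕ-add-sub (+ _) w) (m<n⇒m%n≡m k<d))

  +-%ℕ-injective : ∀ {i i′} (c : ℤ) → i < d → i′ < d →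
                   (+ i ℤ.+ c) %ℕ d ≡ (+ i′ ℤ.+ c) %ℕ d → i ≡ i′
  +-%ℕ-injective {i} {i′} c i<d i′<d eq = begin
    i                                  ≡⟨ %ℕ-shift-inverse c i<d refl ⟩
    (+ ((+ i ℤ.+ c) %ℕ d) ℤ.- c) %ℕ d  ≡⟨ cong (λ r → (+ r ℤ.- c) %ℕ d) eq ⟩
    (+ ((+ i′ ℤ.+ c) %ℕ d) ℤ.- c) %ℕ d ≡⟨ %ℕ-shift-inverse c i′<d refl ⟨
    i′                                 ∎

  %ℕ-suc-suc≢ : 2 < d → ∀ x → (+ ((x ℤ.+ + 1) %ℕ d) ℤ.+ + 1) %ℕ d ≢ x %ℕ d
  %ℕ-suc-suc≢ 2<d x eq = [m+k]%n≢m (x %ℕ d) (s≤s z≤n) 2<d (begin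
    (+ (x %ℕ d) ℤ.+ + 2) %ℕ d           ≡⟨ %ℕ-absorbˡ x (+ 2) ⟩
    (x ℤ.+ + 2) %ℕ d                    ≡⟨ cong (_%ℕ d) (ℤ.+-assoc x (+ 1) (+ 1)) ⟨
    (x ℤ.+ + 1 ℤ.+ + 1) %ℕ d            ≡⟨ %ℕ-absorbˡ (x ℤ.+ + 1) (+ 1) ⟨
    (+ ((x ℤ.+ + 1) %ℕ d) ℤ.+ + 1) %ℕ d ≡⟨ eq ⟩
    x %ℕ d                              ∎)

SameEdge-sym : ∀ {e e′} → SameEdge e e′ → SameEdge e′ e
SameEdge-sym (inj₁ (refl , refl)) = inj₁ (refl , refl)
SameEdge-sym (inj₂ (refl , refl)) = inj₂ (refl , refl)

SameEdge-trans : ∀ {e e′ e″} → SameEdge e e′ → SameEdge e′ e″ → SameEdge e e″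
SameEdge-trans (inj₁ (refl , refl)) q                    = q
SameEdge-trans (inj₂ (refl , refl)) (inj₁ (refl , refl)) = inj₂ (refl , refl)
SameEdge-trans (inj₂ (refl , refl)) (inj₂ (refl , refl)) = inj₁ (refl , refl)

≡⇒SameEdge : ∀ {e e′} → e ≡ e′ → SameEdge e e′
≡⇒SameEdge refl = inj₁ (refl , refl)

retarget : ∀ {e a a′ b b′} → SameEdge a a′ × SameEdge b b′ →
           SameEdge e a ⊎ SameEdge e b → SameEdge e a′ ⊎ SameEdge e b′
retarget (a≈a′ , b≈b′) = Sum.map (λ r → SameEdge-trans r a≈a′) (λ r → SameEdge-trans r b≈b′)

retarget-back : ∀ {e a a′ b b′} → SameEdge a a′ × SameEdge b b′ →
                SameEdge e a′ ⊎ SameEdge e b′ → SameEdge e a ⊎ SameEdge e b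
retarget-back (a≈a′ , b≈b′) = retarget (SameEdge-sym a≈a′ , SameEdge-sym b≈b′)

module Columns (s₀ t₀ : ℕ) where

  s t ℓ T : ℕ
  s = suc s₀
  t = suc t₀
  ℓ = ell s t
  T = t * (2 * hh s t + 1)

  suc-%′ : ∀ j → suc j %′ s ≡ zmod (+ j ℤ.+ + 1) s
  suc-%′ j = cong (_% s) (ℕ.+-comm 1 j)

  -- With w = ℤ.- + 1, the term x ℤ.- w reduces to x ℤ.+ + 1, so %ℕ-shift-inverse serves both directions.
  Adj-sym : ∀ {u v} → IsVertex s t u → Adj s t u v → Adj s t v u
  Adj-sym (_ , k<t) (inj₁ (refl , inj₁ up))    = inj₁ (refl , inj₂ (%ℕ-shift-inverse (+ 1) k<t up))
  Adj-sym (_ , k<t) (inj₁ (refl , inj₂ down))  = inj₁ (refl , inj₁ (%ℕ-shift-inverse (ℤ.- + 1) k<t down))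
  Adj-sym (j<s , _) (inj₂ (refl , inj₁ right)) = inj₂ (refl , inj₂ (%ℕ-shift-inverse (+ 1) j<s right))
  Adj-sym (j<s , _) (inj₂ (refl , inj₂ left))  = inj₂ (refl , inj₁ (%ℕ-shift-inverse (ℤ.- + 1) j<s left))

  IsEdge-resp : ∀ {e e′} → SameEdge e e′ → IsEdge s t e′ → IsEdge s t e
  IsEdge-resp (inj₁ (refl , refl)) p                 = p
  IsEdge-resp (inj₂ (refl , refl)) (u∈ , v∈ , u~v) = v∈ , u∈ , Adj-sym u∈ u~v

  vplus-isEdge : ∀ {j} (x : ℤ) → j < s → IsEdge s t (vplus s t j x)
  vplus-isEdge x j<s =
    (j<s , n%ℕd<d x t) , (j<s , n%ℕd<d (x ℤ.+ + 1) t) , inj₁ (refl , inj₁ (sym (%ℕ-absorbˡ x (+ 1))))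

  hor-isEdge : ∀ {j} (x : ℤ) → j < s → IsEdge s t (hor s t j x)
  hor-isEdge {j} x j<s =
    (j<s , n%ℕd<d x t) , (m%n<n (suc j) s , n%ℕd<d x t) , inj₂ (refl , inj₁ (suc-%′ j))

  IsEdge⇒vplus⊎hor : ∀ {e} → IsEdge s t e →
    ∃₂ λ j (x : ℤ) → j < s × (SameEdge e (vplus s t j x) ⊎ SameEdge e (hor s t j x))
  IsEdge⇒vplus⊎hor {(j , k) , _} ((j<s , k<t) , _ , inj₁ (refl , inj₁ up)) =
    j , + k , j<s , inj₁ (inj₁ (cong (j ,_) (sym (m<n⇒m%n≡m k<t)) , cong (j ,_) up))
  IsEdge⇒vplus⊎hor {(j , k) , (_ , k′)} ((j<s , k<t) , (_ , k′<t) , inj₁ (refl , inj₂ down)) =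
    j , + k′ , j<s ,
    inj₁ (inj₂ (cong (j ,_) (%ℕ-shift-inverse (ℤ.- + 1) k<t down) , cong (j ,_) (sym (m<n⇒m%n≡m k′<t))))
  IsEdge⇒vplus⊎hor {(j , k) , _} ((j<s , k<t) , _ , inj₂ (refl , inj₁ right)) =
    j , + k , j<s , inj₂ (inj₁ (cong (j ,_) k≡ , cong₂ _,_ (trans right (sym (suc-%′ j))) k≡))
    where k≡ = sym (m<n⇒m%n≡m k<t)
  IsEdge⇒vplus⊎hor {(j , k) , (j′ , _)} ((j<s , k<t) , (j′<s , _) , inj₂ (refl , inj₂ left)) =
    j′ , + k , j′<s ,
    inj₂ (inj₂ (cong₂ _,_ (trans (%ℕ-shift-inverse (ℤ.- + 1) j<s left) (sym (suc-%′ j′))) k≡ , cong (j′ ,_) k≡))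
    where k≡ = sym (m<n⇒m%n≡m k<t)

  vplus-cong : ∀ j (x y : ℤ) → zmod x t ≡ zmod y t → vplus s t j x ≡ vplus s t j y
  vplus-cong j x y eq = cong₂ (λ a b → (j , a) , (j , b)) eq (begin
    zmod (x ℤ.+ + 1) t          ≡⟨ %ℕ-absorbˡ x (+ 1) ⟨
    zmod (+ zmod x t ℤ.+ + 1) t ≡⟨ cong (λ a → zmod (+ a ℤ.+ + 1) t) eq ⟩
    zmod (+ zmod y t ℤ.+ + 1) t ≡⟨ %ℕ-absorbˡ y (+ 1) ⟩
    zmod (y ℤ.+ + 1) t          ∎)

  hor-cong : ∀ j (x y : ℤ) → zmod x t ≡ zmod y t → hor s t j x ≡ hor s t j y
  hor-cong j _ _ eq = cong (λ a → (j , a) , (suc j %′ s , a)) eq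

  vplus-SameEdge : 3 ≤ t → ∀ {j j′} (x y : ℤ) →
    SameEdge (vplus s t j x) (vplus s t j′ y) → j ≡ j′ × zmod x t ≡ zmod y t
  vplus-SameEdge _ x y (inj₁ (same , _)) = ,-injectiveˡ same , ,-injectiveʳ same
  vplus-SameEdge 3≤t x y (inj₂ (cross₁ , cross₂)) = ⊥-elim (%ℕ-suc-suc≢ 3≤t y (begin
    zmod (+ zmod (y ℤ.+ + 1) t ℤ.+ + 1) t ≡⟨ cong (λ a → zmod (+ a ℤ.+ + 1) t) (,-injectiveʳ cross₁) ⟨
    zmod (+ zmod x t ℤ.+ + 1) t           ≡⟨ %ℕ-absorbˡ x (+ 1) ⟩
    zmod (x ℤ.+ + 1) t                    ≡⟨ ,-injectiveʳ cross₂ ⟩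
    zmod y t                              ∎))

  hor-SameEdge : 3 ≤ s → ∀ {j j′} (x y : ℤ) → j < s →
    SameEdge (hor s t j x) (hor s t j′ y) → j ≡ j′ × zmod x t ≡ zmod y t
  hor-SameEdge _ x y _ (inj₁ (same , _)) = ,-injectiveˡ same , ,-injectiveʳ same
  hor-SameEdge 3≤s {j} {j′} x y j<s (inj₂ (cross₁ , cross₂)) = ⊥-elim (%ℕ-suc-suc≢ 3≤s (+ j) (begin
    zmod (+ zmod (+ j ℤ.+ + 1) s ℤ.+ + 1) s ≡⟨ cong (λ a → zmod (+ a ℤ.+ + 1) s) (suc-%′ j) ⟨
    zmod (+ (suc j %′ s) ℤ.+ + 1) s         ≡⟨ cong (λ a → zmod (+ a ℤ.+ + 1) s) (,-injectiveˡ cross₂) ⟩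
    zmod (+ j′ ℤ.+ + 1) s                   ≡⟨ suc-%′ j′ ⟨
    suc j′ %′ s                             ≡⟨ ,-injectiveˡ cross₁ ⟨
    j                                       ≡⟨ m<n⇒m%n≡m j<s ⟨
    zmod (+ j) s                            ∎))

  vplus≉hor : 1 < s → ∀ {j j′} (x y : ℤ) → ¬ SameEdge (vplus s t j x) (hor s t j′ y)
  vplus≉hor 1<s {j′ = j′} x y (inj₁ (p , q)) =
    [m+k]%n≢m j′ (s≤s z≤n) 1<s (trans (sym (suc-%′ j′)) (trans (sym (,-injectiveˡ q)) (,-injectiveˡ p)))
  vplus≉hor 1<s {j′ = j′} x y (inj₂ (p , q)) =
    [m+k]%n≢m j′ (s≤s z≤n) 1<s (trans (sym (suc-%′ j′)) (trans (sym (,-injectiveˡ p)) (,-injectiveˡ q)))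

  descending : ℕ → ℤ
  descending j = + (2 * ℓ) ℤ.- + 1 ℤ.- + j

  staircase : (ℕ → ℤ) → ℕ → ℤ
  staircase f j with j ℕ.<? ℓ
  ... | yes _ = f j
  ... | no  _ = descending j

  staircase-< : ∀ f {j} → j < ℓ → staircase f j ≡ f j
  staircase-< f {j} j<ℓ with j ℕ.<? ℓ
  ... | yes _  = refl
  ... | no j≮ℓ = ⊥-elim (j≮ℓ j<ℓ)

  staircase-≮ : ∀ f {j} → ¬ j < ℓ → staircase f j ≡ descending j
  staircase-≮ f {j} j≮ℓ with j ℕ.<? ℓ
  ... | yes j<ℓ = ⊥-elim (j≮ℓ j<ℓ)
  ... | no _    = refl

  vOffset hOffset : ℕ → ℤ
  vOffset = staircase (λ j → + j)
  hOffset = staircase (λ j → + j ℤ.+ + 1)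

  vEdge hEdge : ℕ → ℕ → Edge
  vEdge i j = vplus s t j (+ i ℤ.+ vOffset j)
  hEdge i j = hor s t j (+ i ℤ.+ hOffset j)

  ColumnEdge : ℕ → Edge → Set
  ColumnEdge i e = ∃ λ j → j < s × (SameEdge e (vEdge i j) ⊎ SameEdge e (hEdge i j))

  vplus≡vEdge : ∀ j (x : ℤ) → vplus s t j x ≡ vEdge (zmod (x ℤ.- vOffset j) t) j
  vplus≡vEdge j x = vplus-cong j x (+ zmod (x ℤ.- vOffset j) t ℤ.+ vOffset j) (sym (%ℕ-sub-add {t} x (vOffset j)))

  hor≡hEdge : ∀ j (x : ℤ) → hor s t j x ≡ hEdge (zmod (x ℤ.- hOffset j) t) j
  hor≡hEdge j x = hor-cong j x (+ zmod (x ℤ.- hOffset j) t ℤ.+ hOffset j) (sym (%ℕ-sub-add {t} x (hOffset j)))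

  Z₁-edges : ∀ i {j} → j < ℓ →
    SameEdge (vplus s t j (+ i ℤ.+ + j)) (vEdge i j) × SameEdge (hor s t j (+ i ℤ.+ + j ℤ.+ + 1)) (hEdge i j)
  Z₁-edges i {j} j<ℓ =
    ≡⇒SameEdge (cong (λ c → vplus s t j (+ i ℤ.+ c)) (sym (staircase-< _ j<ℓ))) ,
    ≡⇒SameEdge (cong (hor s t j)
      (trans (ℤ.+-assoc (+ i) (+ j) (+ 1)) (cong (λ c → + i ℤ.+ c) (sym (staircase-< _ j<ℓ)))))

  vminus≈vplus : ∀ j k → SameEdge (vminus s t j k) (vplus s t j (k ℤ.- + 1))
  vminus≈vplus j k = inj₂ (cong (λ x → j , zmod x t) (k≡k-1+1 k) , refl)
    where
    k≡k-1+1 : ∀ (k : ℤ) → k ≡ k ℤ.- + 1 ℤ.+ + 1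
    k≡k-1+1 = ℤ-Ring.solve-∀

  descending-edges : ∀ i {j} → ¬ j < ℓ → ∀ k → k ≡ + i ℤ.+ + (2 * ℓ) ℤ.- + j →
    SameEdge (vminus s t j k) (vEdge i j) × SameEdge (hor s t j (k ℤ.- + 1)) (hEdge i j)
  descending-edges i {j} j≮ℓ k refl =
    SameEdge-trans (vminus≈vplus j k) (≡⇒SameEdge (cong (vplus s t j) (below-top _))) ,
    ≡⇒SameEdge (cong (hor s t j) (below-top _))
    where
    regroup : ∀ (a L b : ℤ) → a ℤ.+ L ℤ.- b ℤ.- + 1 ≡ a ℤ.+ (L ℤ.- + 1 ℤ.- b)
    regroup = ℤ-Ring.solve-∀
    below-top : ∀ f → k ℤ.- + 1 ≡ + i ℤ.+ staircase f j
    below-top f = trans (regroup (+ i) (+ (2 * ℓ)) (+ j)) (cong (λ c → + i ℤ.+ c) (sym (staircase-≮ f j≮ℓ)))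

  Z₂-edges : ∀ i j →
    SameEdge (vminus s t (j + ℓ) (+ i ℤ.- + j ℤ.+ + ℓ)) (vEdge i (j + ℓ)) ×
    SameEdge (hor s t (j + ℓ) (+ i ℤ.- + j ℤ.+ + ℓ ℤ.- + 1)) (hEdge i (j + ℓ))
  Z₂-edges i j = descending-edges i (λ j+ℓ<ℓ → ℕ.<⇒≱ j+ℓ<ℓ (ℕ.m≤n+m ℓ j)) _ (top (+ i) (+ j) (+ ℓ))
    where
    -- + (2 * ℓ) unfolds to + ℓ ℤ.+ (+ ℓ ℤ.+ + 0)
    top : ∀ (a b l : ℤ) → a ℤ.- b ℤ.+ l ≡ a ℤ.+ (l ℤ.+ (l ℤ.+ + 0)) ℤ.- (b ℤ.+ l)
    top = ℤ-Ring.solve-∀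

  Z₃-edges : ∀ i j →
    SameEdge (vminus s t (j + 2 * ℓ) (+ i ℤ.- + j)) (vEdge i (j + 2 * ℓ)) ×
    SameEdge (hor s t (j + 2 * ℓ) (+ i ℤ.- + j ℤ.- + 1)) (hEdge i (j + 2 * ℓ))
  Z₃-edges i j = descending-edges i j+2ℓ≮ℓ _ (top (+ i) (+ j) (+ (2 * ℓ)))
    where
    j+2ℓ≮ℓ : ¬ j + 2 * ℓ < ℓ
    j+2ℓ≮ℓ j+2ℓ<ℓ = ℕ.<⇒≱ j+2ℓ<ℓ (ℕ.≤-trans (ℕ.m≤m+n ℓ (ℓ + 0)) (ℕ.m≤n+m _ j))
    top : ∀ (a b L : ℤ) → a ℤ.- b ≡ a ℤ.+ L ℤ.- (b ℤ.+ L)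
    top = ℤ-Ring.solve-∀

  ColumnEdge-unique : 3 ≤ t → 3 ≤ s → ∀ {i i′ e} → i < t → i′ < t →
                      ColumnEdge i e → ColumnEdge i′ e → i ≡ i′
  ColumnEdge-unique 3≤t _ {i} {i′} i<t i′<t (j , _ , inj₁ x) (j′ , _ , inj₁ y)
    with vplus-SameEdge 3≤t (+ i ℤ.+ vOffset j) (+ i′ ℤ.+ vOffset j′) (SameEdge-trans (SameEdge-sym x) y)
  ... | refl , eq = +-%ℕ-injective (vOffset j) i<t i′<t eq
  ColumnEdge-unique _ 3≤s {i} {i′} _ _ (j , _ , inj₁ x) (j′ , _ , inj₂ y) =
    ⊥-elim (vplus≉hor (ℕ.≤-trans (ℕ.n≤1+n 2) 3≤s) (+ i ℤ.+ vOffset j) (+ i′ ℤ.+ hOffset j′)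
                      (SameEdge-trans (SameEdge-sym x) y))
  ColumnEdge-unique _ 3≤s {i} {i′} _ _ (j , _ , inj₂ x) (j′ , _ , inj₁ y) =
    ⊥-elim (vplus≉hor (ℕ.≤-trans (ℕ.n≤1+n 2) 3≤s) (+ i′ ℤ.+ vOffset j′) (+ i ℤ.+ hOffset j)
                      (SameEdge-trans (SameEdge-sym y) x))
  ColumnEdge-unique _ 3≤s {i} {i′} i<t i′<t (j , j<s , inj₂ x) (j′ , _ , inj₂ y)
    with hor-SameEdge 3≤s (+ i ℤ.+ hOffset j) (+ i′ ℤ.+ hOffset j′) j<s (SameEdge-trans (SameEdge-sym x) y)
  ... | refl , eq = +-%ℕ-injective (hOffset j) i<t i′<t eq

  module _ (s≡2ℓ+T : s ≡ 2 * ℓ + T) where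

    2ℓ≡ℓ+ℓ : 2 * ℓ ≡ ℓ + ℓ
    2ℓ≡ℓ+ℓ = cong (_+_ ℓ) (ℕ.+-identityʳ ℓ)

    2ℓ≤s : 2 * ℓ ≤ s
    2ℓ≤s = subst (2 * ℓ ≤_) (sym s≡2ℓ+T) (ℕ.m≤m+n (2 * ℓ) T)

    Z₁-column<s : ∀ {j} → j < ℓ → j < s
    Z₁-column<s j<ℓ = ℕ.<-≤-trans j<ℓ (ℕ.≤-trans (ℕ.m≤m+n ℓ (ℓ + 0)) 2ℓ≤s)

    Z₂-column<s : ∀ {j} → j < ℓ → j + ℓ < s
    Z₂-column<s j<ℓ = ℕ.<-≤-trans (ℕ.+-monoˡ-< ℓ j<ℓ) (subst (_≤ s) 2ℓ≡ℓ+ℓ 2ℓ≤s)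

    Z₃-column<s : ∀ {j} → j < T → j + 2 * ℓ < s
    Z₃-column<s {j} j<T =
      subst (j + 2 * ℓ <_) (sym (trans s≡2ℓ+T (ℕ.+-comm (2 * ℓ) T))) (ℕ.+-monoˡ-< (2 * ℓ) j<T)

    column-blocks : ∀ {j} → j < s →
      j < ℓ ⊎ (∃ λ j′ → j′ < ℓ × j ≡ j′ + ℓ) ⊎ (∃ λ j′ → j′ < T × j ≡ j′ + 2 * ℓ)
    column-blocks {j} j<s with j ℕ.<? ℓ | j ℕ.<? 2 * ℓ
    ... | yes j<ℓ | _        = inj₁ j<ℓ
    ... | no j≮ℓ  | yes j<2ℓ = inj₂ (inj₁ (j ∸ ℓ ,
      subst (j ∸ ℓ <_) (ℕ.m+n∸n≡m ℓ ℓ) (ℕ.∸-monoˡ-< (subst (j <_) 2ℓ≡ℓ+ℓ j<2ℓ) (ℕ.≮⇒≥ j≮ℓ)) ,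
      sym (ℕ.m∸n+n≡m (ℕ.≮⇒≥ j≮ℓ))))
    ... | no _    | no j≮2ℓ  = inj₂ (inj₂ (j ∸ 2 * ℓ ,
      subst (j ∸ 2 * ℓ <_) (ℕ.m+n∸m≡n (2 * ℓ) T) (ℕ.∸-monoˡ-< (subst (j <_) s≡2ℓ+T j<s) (ℕ.≮⇒≥ j≮2ℓ)) ,
      sym (ℕ.m∸n+n≡m (ℕ.≮⇒≥ j≮2ℓ))))

    InZ⇒ColumnEdge : ∀ {i e} → InZ s t i e → ColumnEdge i e
    InZ⇒ColumnEdge {i} (inj₁ (j , j<ℓ , q))       = j , Z₁-column<s j<ℓ , retarget (Z₁-edges i j<ℓ) q
    InZ⇒ColumnEdge {i} (inj₂ (inj₁ (j , j<ℓ , q))) = j + ℓ , Z₂-column<s j<ℓ , retarget (Z₂-edges i j) q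
    InZ⇒ColumnEdge {i} (inj₂ (inj₂ (j , j<T , q))) = j + 2 * ℓ , Z₃-column<s j<T , retarget (Z₃-edges i j) q

    ColumnEdge⇒InZ : ∀ {i e} → ColumnEdge i e → InZ s t i e
    ColumnEdge⇒InZ {i} (j , j<s , q) with column-blocks j<s
    ... | inj₁ j<ℓ                      = inj₁ (j , j<ℓ , retarget-back (Z₁-edges i j<ℓ) q)
    ... | inj₂ (inj₁ (j′ , j′<ℓ , refl)) = inj₂ (inj₁ (j′ , j′<ℓ , retarget-back (Z₂-edges i j′) q))
    ... | inj₂ (inj₂ (j′ , j′<T , refl)) = inj₂ (inj₂ (j′ , j′<T , retarget-back (Z₃-edges i j′) q))

  ColumnEdge⇒IsEdge : ∀ {i e} → ColumnEdge i e → IsEdge s t e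
  ColumnEdge⇒IsEdge {i} (j , j<s , inj₁ q) = IsEdge-resp q (vplus-isEdge (+ i ℤ.+ vOffset j) j<s)
  ColumnEdge⇒IsEdge {i} (j , j<s , inj₂ q) = IsEdge-resp q (hor-isEdge (+ i ℤ.+ hOffset j) j<s)

  IsEdge⇒ColumnEdge : ∀ {e} → IsEdge s t e → ∃ λ i → i < t × ColumnEdge i e
  IsEdge⇒ColumnEdge p with IsEdge⇒vplus⊎hor p
  ... | j , x , j<s , inj₁ q = zmod (x ℤ.- vOffset j) t , n%ℕd<d (x ℤ.- vOffset j) t ,
                               j , j<s , inj₁ (subst (SameEdge _) (vplus≡vEdge j x) q)
  ... | j , x , j<s , inj₂ q = zmod (x ℤ.- hOffset j) t , n%ℕd<d (x ℤ.- hOffset j) t ,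
                               j , j<s , inj₂ (subst (SameEdge _) (hor≡hEdge j x) q)

odd-split : ∀ a b → let s = suc (2 * a); t = suc (2 * b) in
  t ≤ s → s ≡ 2 * ell s t + t * (2 * hh s t + 1)
odd-split a b t≤s = begin
  s                                    ≡⟨ ℕ.m∸n+n≡m t≤s ⟨
  s ∸ t + t                            ≡⟨ cong (_+ t) s∸t≡2m ⟩
  2 * m + t                            ≡⟨ cong (λ x → 2 * x + t) (m≡m%n+[m/n]*n m t) ⟩
  2 * (m % t + m / t * t) + t          ≡⟨ regroup (m % t) (m / t) t ⟩
  2 * (m % t) + t * (2 * (m / t) + 1)  ≡⟨ cong₂ (λ r q → 2 * r + t * (2 * q + 1)) ell≡ hh≡ ⟨
  2 * ell s t + t * (2 * hh s t + 1)   ∎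
  where
  s = suc (2 * a)
  t = suc (2 * b)
  m = a ∸ b
  s∸t≡2m : s ∸ t ≡ 2 * m
  s∸t≡2m = sym (ℕ.*-distribˡ-∸ 2 a b)
  ell≡ : ell s t ≡ m % t
  ell≡ = trans (cong (λ x → (x / 2) % t) (trans s∸t≡2m (ℕ.*-comm 2 m))) (cong (_% t) (m*n/n≡m m 2))
  hh≡ : hh s t ≡ m / t
  hh≡ = trans (cong (_/ (2 * t)) s∸t≡2m) (m*n/m*o≡n/o 2 m t)
  regroup : ∀ r q t → 2 * (r + q * t) + t ≡ 2 * r + t * (2 * q + 1)
  regroup = ℕ-Ring.solve-∀

proposition10 : (s t : ℕ) → Odd s → Odd t → 3 ≤ t → t ≤ s → IsEdgePartition s t
proposition10 .(suc (2 * a)) .(suc (2 * b)) (a , refl) (b , refl) 3≤t t≤s =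
    (λ _ _ _ z → ColumnEdge⇒IsEdge (InZ⇒ColumnEdge s≡2ℓ+T z))
  , (λ i _ → vEdge i 0 , ColumnEdge⇒InZ s≡2ℓ+T (0 , s≤s z≤n , inj₁ (≡⇒SameEdge refl)))
  , (λ _ e∈E → let i , i<t , c = IsEdge⇒ColumnEdge e∈E in i , i<t , ColumnEdge⇒InZ s≡2ℓ+T c)
  , (λ _ _ _ i<t i′<t z z′ →
       ColumnEdge-unique 3≤t 3≤s i<t i′<t (InZ⇒ColumnEdge s≡2ℓ+T z) (InZ⇒ColumnEdge s≡2ℓ+T z′))
  where
  open Columns (2 * a) (2 * b)
  s≡2ℓ+T = odd-split a b t≤s
  3≤s = ℕ.≤-trans 3≤t t≤s
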